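{- There exists a strategy in the post-positional semi-random graph process that a.a.s. constructs a multigraph on $[n]$ containing an induced simple $(n-1)$-cycle in $O(n\ln n)$ rounds.
   Context: Post-positional semi-random graph process on $[n]$: $G_0$ is the empty multigraph; in round $t$, $u_t$ is chosen uniformly at random from $[n]$, the player chooses $v_t$ possibly depending on the history and on $u_t$, and the edge $u_tv_t$ is added (multiple edges and loops are kept). An induced simple $(n-1)$-cycle is a set $S$ of $n-1$ vertices whose induced underlying simple graph is a cycle of length $n-1$. A.a.s. means with probability tending to $1$ as $n\to\infty$. -}

module Defs where

open import Data.Nat using (ℕ; zero; suc; _+_; _*_; _∸_; _^_; _≤_)
open import Data.Nat.Logarithm using (⌊log₂_⌋)
open import Data.Fin using (Fin; toℕ)
open import Data.Product using (Σ; ∃; _×_; _,_)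
open import Data.Sum using (_⊎_)
open import Data.List using (List; []; _∷_; _++_; [_]; take; length)
open import Data.List.Membership.Propositional using (_∈_)
open import Data.List.Relation.Unary.All using (All)
open import Data.List.Relation.Unary.Unique.Propositional using (Unique)
open import Data.Vec using (Vec; toList)
open import Function.Bundles using (_⇔_)
open import Function.Definitions using (Injective)
open import Relation.Binary.PropositionalEquality using (_≡_)
open import Relation.Nullary using (¬_)

-- A multigraph on [n] = Fin n, given as the list of its edges (in the order
-- they were added); loops and repeated edges are allowed.
Edge : ℕ → Set
Edge n = Fin n × Fin n

MultiGraph : ℕ → Set
MultiGraph n = List (Edge n)

Adj : {n : ℕ} → MultiGraph n → Fin n → Fin n → Set
Adj G x y = ¬ (x ≡ y) × ((x , y) ∈ G ⊎ (y , x) ∈ G)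

CycNbr : (k : ℕ) → Fin k → Fin k → Set
CycNbr k i j =
  (toℕ j ≡ suc (toℕ i)) ⊎ (toℕ i ≡ suc (toℕ j))
  ⊎ ((toℕ i ≡ 0 × suc (toℕ j) ≡ k) ⊎ (toℕ j ≡ 0 × suc (toℕ i) ≡ k))

HasInducedCycle : {n : ℕ} → MultiGraph n → ℕ → Set
HasInducedCycle {n} G k =
  3 ≤ k × Σ (Fin k → Fin n) (λ c →
    Injective _≡_ _≡_ c × (∀ i j → Adj G (c i) (c j) ⇔ CycNbr k i j))

-- A (deterministic) strategy of the player in the post-positional process:
-- given the history (edges so far) and the random vertex u_t, choose v_t.
Strategy : ℕ → Set
Strategy n = MultiGraph n → Fin n → Fin n

runFrom : {n : ℕ} → Strategy n → MultiGraph n → List (Fin n) → MultiGraph n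
runFrom s h [] = h
runFrom s h (u ∷ us) = runFrom s (h ++ [ (u , s h u) ]) us

graphAt : {n : ℕ} → Strategy n → List (Fin n) → ℕ → MultiGraph n
graphAt s us t = runFrom s [] (take t us)

Succeeds : {n T : ℕ} → Strategy n → Vec (Fin n) T → Set
Succeeds {n} {T} s us =
  ∃ λ t → t ≤ T × HasInducedCycle (graphAt s (toList us) t) (n ∸ 1)

-- "P(success within T rounds) ≥ 1 - 1/q" under the uniform measure on
-- (u_1,...,u_T) ∈ [n]^T: there are at least (1 - 1/q) n^T distinct
-- successful outcomes.
SuccessProbAtLeast : (n T q : ℕ) → Strategy n → Set
SuccessProbAtLeast n T q s =
  Σ (List (Vec (Fin n) T)) λ L →
    Unique L × All (Succeeds s) L × ((q ∸ 1) * n ^ T ≤ q * length L)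

rounds : ℕ → ℕ → ℕ
rounds C n = C * n * (⌊log₂ n ⌋ + 1)

-- The player ignores the history and answers u by its cyclic successor among the
-- vertices 1, …, n-1, answering 0 by a loop. As soon as every vertex has been drawn,
-- the edges u → succ(u) make the underlying simple graph on 1, …, n-1 exactly a
-- cycle. Counting outcomes, a union bound over the missed vertex shows that at most
-- n (n-1)^T of the n^T sequences miss a vertex, and Bernoulli's inequality gives
-- (1 - 1/n)^n ≤ 1/2, so for T = 2n(⌊log₂ n⌋ + 1) ≥ n log₂(n²) this is at most
-- n^T / n ≤ n^T / q.

module Submission where

open import Defs
open import Data.Nat using (ℕ; zero; suc; _+_; _*_; _∸_; _^_; _≤_; _<_; z≤n; s≤s; _≤?_; _<?_)
open import Data.Nat.Properties hiding (_≟_)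
open import Data.Nat.ListAction using (sum)
open import Data.Nat.Logarithm using (⌊log₂_⌋; ⌊log₂⌋-mono-≤; ⌊log₂[2^n]⌋≡n)
open import Data.Nat.Tactic.RingSolver using (solve-∀)
open import Data.Fin using (Fin; zero; suc; toℕ; fromℕ<)
open import Data.Fin.Properties using (_≟_; toℕ-injective; toℕ-fromℕ<; toℕ<n; ¬∀⟶∃¬)
import Data.Fin.Properties as Fin
open import Data.List using (List; []; _∷_; [_]; _++_; map; length; filter; allFin; cartesianProductWith)
open import Data.List.Properties
  using (++-assoc; ++-identityʳ; take-all; length-++; length-map; length-tabulate;
         filter-++; filter-accept; filter-none; filter-notAll)
open import Data.List.Relation.Unary.Any as Any using (Any; here; there)
open import Data.List.Relation.Unary.All as All using (All; []; _∷_; all?; universal)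
open import Data.List.Relation.Unary.All.Properties using (¬Any⇒All¬; all-filter; map⁺)
import Data.List.Relation.Unary.AllPairs as AllPairs
open import Data.List.Relation.Unary.Unique.Propositional using (Unique)
open import Data.List.Relation.Unary.Unique.Propositional.Properties using (cartesianProductWith⁺; filter⁺; allFin⁺)
open import Data.List.Membership.Propositional using (_∈_; lose)
open import Data.List.Membership.Propositional.Properties using (∈-allFin; ∈-map⁺; ∈-map⁻)
open import Data.Vec using (Vec; []; _∷_; toList)
open import Data.Vec.Properties using (∷-injective; length-toList)
open import Data.Product using (Σ; ∃; _×_; _,_)
open import Data.Sum using (_⊎_; inj₁; inj₂)
open import Function using (_∘_)
open import Function.Bundles using (_⇔_; mk⇔; Equivalence)
open import Function.Definitions using (Injective)
open import Level using (0ℓ)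
open import Relation.Binary.PropositionalEquality using (_≡_; refl; sym; trans; cong; cong₂; subst; module ≡-Reasoning)
open import Relation.Nullary using (¬_; yes; no; contradiction)
open import Relation.Unary using (Pred; Decidable; ∁)
open import Relation.Unary.Properties using (∁?)

private variable
  A B : Set

-- (1 + 1/m)^k ≥ 1 + k/m, cleared of denominators.
bernoulli : ∀ m k → m ^ k * (m + k) ≤ suc m ^ k * m
bernoulli m zero = ≤-reflexive (cong (1 *_) (+-identityʳ m))
bernoulli m (suc k) = begin
  m * m ^ k * (m + suc k)    ≡⟨ regroup (m ^ k) m (m + suc k) ⟩
  m ^ k * (m * (m + suc k))  ≤⟨ *-monoʳ-≤ (m ^ k) (≤-trans (m≤m+n _ k) (≤-reflexive (expand m k))) ⟩
  m ^ k * ((m + k) * suc m)  ≡⟨ *-assoc (m ^ k) (m + k) (suc m) ⟨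
  m ^ k * (m + k) * suc m    ≤⟨ *-monoˡ-≤ (suc m) (bernoulli m k) ⟩
  suc m ^ k * m * suc m      ≡⟨ rotate (suc m ^ k) m (suc m) ⟩
  suc m * suc m ^ k * m      ∎
  where
  open ≤-Reasoning
  regroup : ∀ a b c → b * a * c ≡ a * (b * c)
  regroup = solve-∀
  expand : ∀ a b → a * (a + suc b) + b ≡ (a + b) * suc a
  expand = solve-∀
  rotate : ∀ a b c → a * b * c ≡ c * a * b
  rotate = solve-∀

2*m^[1+m]≤[1+m]^[1+m] : ∀ m → 2 * m ^ suc m ≤ suc m ^ suc m
2*m^[1+m]≤[1+m]^[1+m] zero = z≤n
2*m^[1+m]≤[1+m]^[1+m] m@(suc _) = *-cancelˡ-≤ m (begin
  m * (2 * m ^ suc m)      ≡⟨ double m (m ^ suc m) ⟩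
  m ^ suc m * (m + m)      ≤⟨ *-monoʳ-≤ (m ^ suc m) (+-monoʳ-≤ m (n≤1+n m)) ⟩
  m ^ suc m * (m + suc m)  ≤⟨ bernoulli m (suc m) ⟩
  suc m ^ suc m * m        ≡⟨ *-comm _ m ⟩
  m * suc m ^ suc m        ∎)
  where
  open ≤-Reasoning
  double : ∀ a b → a * (2 * b) ≡ b * (a + a)
  double = solve-∀

^-distribʳ-* : ∀ m n k → (m * n) ^ k ≡ m ^ k * n ^ k
^-distribʳ-* m n zero = refl
^-distribʳ-* m n (suc k) = trans (cong (m * n *_) (^-distribʳ-* m n k)) (interchange m n (m ^ k) (n ^ k))
  where
  interchange : ∀ a b c d → a * b * (c * d) ≡ a * c * (b * d)
  interchange = solve-∀

n<2^[1+⌊log₂n⌋] : ∀ n → n < 2 ^ suc ⌊log₂ n ⌋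
n<2^[1+⌊log₂n⌋] n with 2 ^ suc ⌊log₂ n ⌋ ≤? n
... | no 2^[1+L]≰n = ≰⇒> 2^[1+L]≰n
... | yes 2^[1+L]≤n = contradiction
  (≤-trans (≤-reflexive (sym (⌊log₂[2^n]⌋≡n (suc ⌊log₂ n ⌋)))) (⌊log₂⌋-mono-≤ 2^[1+L]≤n))
  (1+n≰n)

q*[n*m^T]≤n^T : ∀ m q → q ≤ suc m → let n = suc m; T = rounds 2 n in q * (n * m ^ T) ≤ n ^ T
q*[n*m^T]≤n^T m q q≤n = begin
  q * (n * m ^ T)            ≤⟨ *-monoˡ-≤ (n * m ^ T) q≤n ⟩
  n * (n * m ^ T)            ≡⟨ *-assoc n n (m ^ T) ⟨
  n * n * m ^ T              ≤⟨ *-monoˡ-≤ (m ^ T) n*n≤2^k ⟩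
  2 ^ k * m ^ T              ≡⟨ cong (λ e → 2 ^ k * m ^ e) T≡n*k ⟩
  2 ^ k * m ^ (n * k)        ≡⟨ cong (2 ^ k *_) (^-*-assoc m n k) ⟨
  2 ^ k * (m ^ n) ^ k        ≡⟨ ^-distribʳ-* 2 (m ^ n) k ⟨
  (2 * m ^ n) ^ k            ≤⟨ ^-monoˡ-≤ k (2*m^[1+m]≤[1+m]^[1+m] m) ⟩
  (n ^ n) ^ k                ≡⟨ ^-*-assoc n n k ⟩
  n ^ (n * k)                ≡⟨ cong (n ^_) T≡n*k ⟨
  n ^ T                      ∎
  where
  open ≤-Reasoning
  n = suc m
  L = ⌊log₂ n ⌋
  T = rounds 2 n
  k = 2 * (L + 1)
  T≡n*k : T ≡ n * k
  T≡n*k = reassoc n (L + 1)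
    where
    reassoc : ∀ a b → 2 * a * b ≡ a * (2 * b)
    reassoc = solve-∀
  n≤2^[L+1] : n ≤ 2 ^ (L + 1)
  n≤2^[L+1] = ≤-trans (<⇒≤ (n<2^[1+⌊log₂n⌋] n)) (≤-reflexive (cong (2 ^_) (+-comm 1 L)))
  n*n≤2^k : n * n ≤ 2 ^ k
  n*n≤2^k = begin
    n * n                    ≤⟨ *-mono-≤ n≤2^[L+1] n≤2^[L+1] ⟩
    2 ^ (L + 1) * 2 ^ (L + 1) ≡⟨ ^-distribˡ-+-* 2 (L + 1) (L + 1) ⟨
    2 ^ (L + 1 + (L + 1))    ≡⟨ cong (2 ^_) (cong (L + 1 +_) (+-identityʳ (L + 1))) ⟨
    2 ^ k                    ∎

[q∸1]*[g+b]≤q*g : ∀ q g b → q * b ≤ g + b → (q ∸ 1) * (g + b) ≤ q * g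
[q∸1]*[g+b]≤q*g q g b q*b≤g+b = begin
  (q ∸ 1) * (g + b)            ≡⟨ *-distribʳ-∸ (g + b) q 1 ⟩
  q * (g + b) ∸ 1 * (g + b)
    ≤⟨ ∸-monoʳ-≤ (q * (g + b)) (≤-trans q*b≤g+b (≤-reflexive (sym (*-identityˡ (g + b))))) ⟩
  q * (g + b) ∸ q * b          ≡⟨ cong (_∸ q * b) (*-distribˡ-+ q g b) ⟩
  q * g + q * b ∸ q * b        ≡⟨ m+n∸n≡m (q * g) (q * b) ⟩
  q * g                        ∎
  where open ≤-Reasoning

module _ {P : Pred A 0ℓ} (P? : Decidable P) where

  length-filter+length-filter-∁ : ∀ xs → length (filter P? xs) + length (filter (∁? P?) xs) ≡ length xs
  length-filter+length-filter-∁ [] = refl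
  length-filter+length-filter-∁ (x ∷ xs) with P? x
  ... | yes _ = cong suc (length-filter+length-filter-∁ xs)
  ... | no _  = trans (+-suc _ _) (cong suc (length-filter+length-filter-∁ xs))

  length-filter-∷-≤ : ∀ x xs → length (filter P? xs) ≤ length (filter P? (x ∷ xs))
  length-filter-∷-≤ x xs with P? x
  ... | yes _ = n≤1+n _
  ... | no _  = ≤-refl

  length-filter-∷-< : ∀ {x} xs → P x → length (filter P? xs) < length (filter P? (x ∷ xs))
  length-filter-∷-< xs px rewrite filter-accept P? {xs = xs} px = ≤-refl

sum-map-mono-≤ : (f g : A → ℕ) → (∀ y → f y ≤ g y) → ∀ ys → sum (map f ys) ≤ sum (map g ys)
sum-map-mono-≤ f g f≤g [] = z≤n
sum-map-mono-≤ f g f≤g (y ∷ ys) = +-mono-≤ (f≤g y) (sum-map-mono-≤ f g f≤g ys)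

sum-map-mono-< : (f g : A → ℕ) → (∀ y → f y ≤ g y) → ∀ {ys} →
  Any (λ y → f y < g y) ys → sum (map f ys) < sum (map g ys)
sum-map-mono-< f g f≤g {_ ∷ ys} (here fy<gy) = +-mono-<-≤ fy<gy (sum-map-mono-≤ f g f≤g ys)
sum-map-mono-< f g f≤g (there any) = +-mono-≤-< (f≤g _) (sum-map-mono-< f g f≤g any)

sum-map-≤-length* : (f : A → ℕ) (c : ℕ) → (∀ y → f y ≤ c) → ∀ ys → sum (map f ys) ≤ length ys * c
sum-map-≤-length* f c f≤c [] = z≤n
sum-map-≤-length* f c f≤c (y ∷ ys) = +-mono-≤ (f≤c y) (sum-map-≤-length* f c f≤c ys)

union-bound : {P : Pred A 0ℓ} (P? : Decidable P) {Q : B → Pred A 0ℓ} (Q? : ∀ y → Decidable (Q y))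
  (ys : List B) → (∀ {x} → P x → Any (λ y → Q y x) ys) →
  ∀ xs → length (filter P? xs) ≤ sum (map (λ y → length (filter (Q? y) xs)) ys)
union-bound P? Q? ys cover [] = z≤n
union-bound P? Q? ys cover (x ∷ xs) with P? x
... | no _   = ≤-trans (union-bound P? Q? ys cover xs)
                 (sum-map-mono-≤ _ _ (λ y → length-filter-∷-≤ (Q? y) x xs) ys)
... | yes px = ≤-trans (s≤s (union-bound P? Q? ys cover xs))
                 (sum-map-mono-< _ _ (λ y → length-filter-∷-≤ (Q? y) x xs)
                   (Any.map (λ {y} → length-filter-∷-< (Q? y) xs) (cover px)))

vectors : List A → (T : ℕ) → List (Vec A T)
vectors xs zero = [ [] ]
vectors xs (suc T) = cartesianProductWith _∷_ xs (vectors xs T)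

vectors-unique : {xs : List A} → Unique xs → ∀ T → Unique (vectors xs T)
vectors-unique xs! zero = [] AllPairs.∷ AllPairs.[]
vectors-unique xs! (suc T) = cartesianProductWith⁺ _∷_ ∷-injective xs! (vectors-unique xs! T)

length-cartesianProductWith : {C : Set} (f : A → B → C) (xs : List A) (ys : List B) →
  length (cartesianProductWith f xs ys) ≡ length xs * length ys
length-cartesianProductWith f [] ys = refl
length-cartesianProductWith f (x ∷ xs) ys = begin
  length (map (f x) ys ++ cartesianProductWith f xs ys)  ≡⟨ length-++ (map (f x) ys) ⟩
  length (map (f x) ys) + length (cartesianProductWith f xs ys)
    ≡⟨ cong₂ _+_ (length-map (f x) ys) (length-cartesianProductWith f xs ys) ⟩
  length ys + length xs * length ys  ∎
  where open ≡-Reasoning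

length-vectors : (xs : List A) (T : ℕ) → length (vectors xs T) ≡ length xs ^ T
length-vectors xs zero = refl
length-vectors xs (suc T) =
  trans (length-cartesianProductWith _∷_ xs (vectors xs T)) (cong (length xs *_) (length-vectors xs T))

module _ {P : Pred A 0ℓ} (P? : Decidable P) where

  allEntries? : ∀ {T} → Decidable (λ (v : Vec A T) → All P (toList v))
  allEntries? = all? P? ∘ toList

  length-filter-allEntries-map-∷ : ∀ {T x} → P x → (vs : List (Vec A T)) →
    length (filter allEntries? (map (x ∷_) vs)) ≡ length (filter allEntries? vs)
  length-filter-allEntries-map-∷ px [] = refl
  length-filter-allEntries-map-∷ {x = x} px (v ∷ vs) with P? x | allEntries? v
  ... | yes _  | yes _ = cong suc (length-filter-allEntries-map-∷ px vs)
  ... | yes _  | no _  = length-filter-allEntries-map-∷ px vs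
  ... | no ¬px | _     = contradiction px ¬px

  length-filter-allEntries-cartesianProduct : ∀ {T} xs (vs : List (Vec A T)) →
    length (filter allEntries? (cartesianProductWith _∷_ xs vs))
      ≡ length (filter P? xs) * length (filter allEntries? vs)
  length-filter-allEntries-cartesianProduct [] vs = refl
  length-filter-allEntries-cartesianProduct (x ∷ xs) vs
    rewrite filter-++ allEntries? (map (x ∷_) vs) (cartesianProductWith _∷_ xs vs)
          | length-++ (filter allEntries? (map (x ∷_) vs)) {filter allEntries? (cartesianProductWith _∷_ xs vs)}
          | length-filter-allEntries-cartesianProduct xs vs
    with P? x
  ... | yes px = cong (_+ _) (length-filter-allEntries-map-∷ px vs)
  ... | no ¬px = cong (_+ _) (cong length (filter-none allEntries?
                   (map⁺ (universal (λ { _ (px ∷ _) → ¬px px }) vs))))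

  length-filter-allEntries-vectors : ∀ xs T →
    length (filter allEntries? (vectors xs T)) ≡ length (filter P? xs) ^ T
  length-filter-allEntries-vectors xs zero = refl
  length-filter-allEntries-vectors xs (suc T) =
    trans (length-filter-allEntries-cartesianProduct xs (vectors xs T))
          (cong (length (filter P? xs) *_) (length-filter-allEntries-vectors xs T))

module _ {n : ℕ} where

  open import Data.List.Membership.DecPropositional (_≟_ {n}) using (_∈?_)

  length-allFin : length (allFin n) ≡ n
  length-allFin = length-tabulate {n = n} (λ i → i)

  Covers : ∀ {T} → Vec (Fin n) T → Set
  Covers v = ∀ x → x ∈ toList v

  covers? : ∀ {T} → Decidable (Covers {T})
  covers? v = Fin.all? (λ x → x ∈? toList v)

  avoids? : ∀ {T} (x : Fin n) → Decidable (λ (v : Vec (Fin n) T) → All (∁ (x ≡_)) (toList v))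
  avoids? x = allEntries? (∁? (x ≟_))

  ¬covers⇒avoids : ∀ {T} {v : Vec (Fin n) T} → ¬ Covers v → Any (λ x → All (∁ (x ≡_)) (toList v)) (allFin n)
  ¬covers⇒avoids {v = v} ¬cov with ¬∀⟶∃¬ n _ (λ x → x ∈? toList v) ¬cov
  ... | x , x∉v = lose (∈-allFin x) (¬Any⇒All¬ (toList v) x∉v)

  length-filter-≢-allFin : (x : Fin n) → length (filter (∁? (x ≟_)) (allFin n)) ≤ n ∸ 1
  length-filter-≢-allFin x = ≤-trans
    (∸-monoˡ-≤ 1 (filter-notAll (∁? (x ≟_)) (allFin n) (Any.map (λ x≡y x≢y → x≢y x≡y) (∈-allFin x))))
    (≤-reflexive (cong (_∸ 1) length-allFin))

  length-filter-avoids : ∀ T (x : Fin n) → length (filter (avoids? x) (vectors (allFin n) T)) ≤ (n ∸ 1) ^ T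
  length-filter-avoids T x = ≤-trans
    (≤-reflexive (length-filter-allEntries-vectors (∁? (x ≟_)) (allFin n) T))
    (^-monoˡ-≤ T (length-filter-≢-allFin x))

  length-filter-¬covers : ∀ T → length (filter (∁? covers?) (vectors (allFin n) T)) ≤ n * (n ∸ 1) ^ T
  length-filter-¬covers T = begin
    length (filter (∁? covers?) (vectors (allFin n) T))
      ≤⟨ union-bound (∁? covers?) avoids? (allFin n) ¬covers⇒avoids (vectors (allFin n) T) ⟩
    sum (map (λ x → length (filter (avoids? x) (vectors (allFin n) T))) (allFin n))
      ≤⟨ sum-map-≤-length* _ _ (length-filter-avoids T) (allFin n) ⟩
    length (allFin n) * (n ∸ 1) ^ T
      ≡⟨ cong (_* (n ∸ 1) ^ T) (length-allFin) ⟩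
    n * (n ∸ 1) ^ T ∎
    where open ≤-Reasoning

  covering-vectors : ∀ T q → q * (n * (n ∸ 1) ^ T) ≤ n ^ T →
    Σ (List (Vec (Fin n) T)) λ L → Unique L × All Covers L × (q ∸ 1) * n ^ T ≤ q * length L
  covering-vectors T q q*n*[n-1]^T≤n^T =
    filter covers? all , filter⁺ covers? (vectors-unique (allFin⁺ n) T) , all-filter covers? all ,
    (begin
      (q ∸ 1) * n ^ T          ≡⟨ cong ((q ∸ 1) *_) good+bad≡n^T ⟨
      (q ∸ 1) * (good + bad)   ≤⟨ [q∸1]*[g+b]≤q*g q good bad q*bad≤good+bad ⟩
      q * good                 ∎)
    where
    open ≤-Reasoning
    all = vectors (allFin n) T
    good = length (filter covers? all)
    bad = length (filter (∁? covers?) all)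
    good+bad≡n^T : good + bad ≡ n ^ T
    good+bad≡n^T = begin-equality
      good + bad         ≡⟨ length-filter+length-filter-∁ covers? all ⟩
      length all         ≡⟨ length-vectors (allFin n) T ⟩
      length (allFin n) ^ T ≡⟨ cong (_^ T) (length-allFin) ⟩
      n ^ T              ∎
    q*bad≤good+bad : q * bad ≤ good + bad
    q*bad≤good+bad = begin
      q * bad                  ≤⟨ *-monoʳ-≤ q (length-filter-¬covers T) ⟩
      q * (n * (n ∸ 1) ^ T)    ≤⟨ q*n*[n-1]^T≤n^T ⟩
      n ^ T                    ≡⟨ good+bad≡n^T ⟨
      good + bad               ∎

CycSucc : (k : ℕ) → Fin k → Fin k → Set
CycSucc k i j = (toℕ j ≡ suc (toℕ i)) ⊎ (toℕ j ≡ 0 × suc (toℕ i) ≡ k)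

cycNbr⇒cycSucc : ∀ {k i j} → CycNbr k i j → CycSucc k i j ⊎ CycSucc k j i
cycNbr⇒cycSucc (inj₁ j≡1+i)               = inj₁ (inj₁ j≡1+i)
cycNbr⇒cycSucc (inj₂ (inj₁ i≡1+j))        = inj₂ (inj₁ i≡1+j)
cycNbr⇒cycSucc (inj₂ (inj₂ (inj₁ wrap))) = inj₂ (inj₂ wrap)
cycNbr⇒cycSucc (inj₂ (inj₂ (inj₂ wrap))) = inj₁ (inj₂ wrap)

cycSucc⇒cycNbr : ∀ {k i j} → CycSucc k i j ⊎ CycSucc k j i → CycNbr k i j
cycSucc⇒cycNbr (inj₁ (inj₁ j≡1+i)) = inj₁ j≡1+i
cycSucc⇒cycNbr (inj₁ (inj₂ wrap))  = inj₂ (inj₂ (inj₂ wrap))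
cycSucc⇒cycNbr (inj₂ (inj₁ i≡1+j)) = inj₂ (inj₁ i≡1+j)
cycSucc⇒cycNbr (inj₂ (inj₂ wrap))  = inj₂ (inj₂ (inj₁ wrap))

cycSucc⇒≢ : ∀ {k i j} → 2 ≤ k → CycSucc k i j → ¬ i ≡ j
cycSucc⇒≢ _ (inj₁ j≡1+i) refl = 1+n≢n (sym j≡1+i)
cycSucc⇒≢ 2≤k (inj₂ (j≡0 , 1+i≡k)) refl = 2≰1 (subst (2 ≤_) (trans (sym 1+i≡k) (cong suc j≡0)) 2≤k)
  where
  2≰1 : ¬ 2 ≤ 1
  2≰1 (s≤s ())

graphOf : {n : ℕ} → (Fin n → Fin n) → List (Fin n) → MultiGraph n
graphOf f us = map (λ u → (u , f u)) us

module _ {n : ℕ} (f : Fin n → Fin n) {us : List (Fin n)} (covers : ∀ x → x ∈ us) where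

  ∈-graphOf⁻ : ∀ {a b} → (a , b) ∈ graphOf f us → f a ≡ b
  ∈-graphOf⁻ e with ∈-map⁻ (λ u → (u , f u)) e
  ... | _ , _ , refl = refl

  ∈-graphOf⁺ : ∀ {a b} → f a ≡ b → (a , b) ∈ graphOf f us
  ∈-graphOf⁺ {a} refl = ∈-map⁺ (λ u → (u , f u)) (covers a)

  graphOf-inducedCycle : ∀ {k} → 3 ≤ k → (c : Fin k → Fin n) → Injective _≡_ _≡_ c →
    (∀ i j → f (c i) ≡ c j ⇔ CycSucc k i j) → HasInducedCycle (graphOf f us) k
  graphOf-inducedCycle {k} 3≤k c c-inj f∘c⇔succ = 3≤k , c , c-inj , λ i j → mk⇔ (adj⇒nbr i j) (nbr⇒adj i j)
    where
    open Equivalence using (to; from)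
    adj⇒nbr : ∀ i j → Adj (graphOf f us) (c i) (c j) → CycNbr k i j
    adj⇒nbr i j (_ , inj₁ ij∈G) = cycSucc⇒cycNbr (inj₁ (to (f∘c⇔succ i j) (∈-graphOf⁻ ij∈G)))
    adj⇒nbr i j (_ , inj₂ ji∈G) = cycSucc⇒cycNbr (inj₂ (to (f∘c⇔succ j i) (∈-graphOf⁻ ji∈G)))
    distinct : ∀ {i j} → CycSucc k i j → ¬ i ≡ j
    distinct = cycSucc⇒≢ (≤-trans (n≤1+n 2) 3≤k)
    nbr⇒adj : ∀ i j → CycNbr k i j → Adj (graphOf f us) (c i) (c j)
    nbr⇒adj i j nbr with cycNbr⇒cycSucc nbr
    ... | inj₁ succ = distinct succ ∘ c-inj , inj₁ (∈-graphOf⁺ (from (f∘c⇔succ i j) succ))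
    ... | inj₂ succ = distinct succ ∘ sym ∘ c-inj , inj₂ (∈-graphOf⁺ (from (f∘c⇔succ j i) succ))

cyclicSuc : ∀ {m} → Fin m → Fin m
cyclicSuc {suc k} i with suc (toℕ i) <? suc k
... | yes 1+i<m = fromℕ< 1+i<m
... | no _      = zero

cyclicSuc≡⇔cycSucc : ∀ {m} (i j : Fin m) → cyclicSuc i ≡ j ⇔ CycSucc m i j
cyclicSuc≡⇔cycSucc {suc k} i j with suc (toℕ i) <? suc k
... | yes 1+i<m = mk⇔
  (λ { refl → inj₁ (toℕ-fromℕ< 1+i<m) })
  (λ { (inj₁ j≡1+i) → toℕ-injective (trans (toℕ-fromℕ< 1+i<m) (sym j≡1+i))
     ; (inj₂ (_ , 1+i≡m)) → contradiction 1+i<m (<-irrefl 1+i≡m) })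
... | no 1+i≮m = mk⇔
  (λ { refl → inj₂ (refl , ≤-antisym (toℕ<n i) (≮⇒≥ 1+i≮m)) })
  (λ { (inj₁ j≡1+i) → contradiction (subst (_< suc k) j≡1+i (toℕ<n j)) 1+i≮m
     ; (inj₂ (j≡0 , _)) → toℕ-injective (sym j≡0) })

cycleStep : ∀ {n} → Fin n → Fin n
cycleStep zero    = zero
cycleStep (suc i) = suc (cyclicSuc i)

cycleStrategy : (n : ℕ) → Strategy n
cycleStrategy n _ = cycleStep

cycleStep-inducedCycle : ∀ {m} → 3 ≤ m → {us : List (Fin (suc m))} → (∀ x → x ∈ us) →
  HasInducedCycle (graphOf cycleStep us) m
cycleStep-inducedCycle 3≤m covers = graphOf-inducedCycle cycleStep covers 3≤m suc Fin.suc-injective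
  λ i j → mk⇔ (Equivalence.to (cyclicSuc≡⇔cycSucc i j) ∘ Fin.suc-injective)
              (cong suc ∘ Equivalence.from (cyclicSuc≡⇔cycSucc i j))

runFrom-const : ∀ {n} (f : Fin n → Fin n) (h : MultiGraph n) us → runFrom (λ _ → f) h us ≡ h ++ graphOf f us
runFrom-const f h [] = sym (++-identityʳ h)
runFrom-const f h (u ∷ us) = trans (runFrom-const f (h ++ [ (u , f u) ]) us) (++-assoc h _ _)

cycleStrategy-succeeds : ∀ {m T} → 3 ≤ m → (v : Vec (Fin (suc m)) T) → Covers v →
  Succeeds (cycleStrategy (suc m)) v
cycleStrategy-succeeds {m} {T} 3≤m v covers =
  T , ≤-refl , subst (λ G → HasInducedCycle G m) (sym graphAt≡graphOf) (cycleStep-inducedCycle 3≤m covers)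
  where
  graphAt≡graphOf : graphAt (cycleStrategy (suc m)) (toList v) T ≡ graphOf cycleStep (toList v)
  graphAt≡graphOf = trans
    (cong (runFrom (cycleStrategy (suc m)) []) (take-all T (toList v) (≤-reflexive (length-toList v))))
    (runFrom-const cycleStep [] (toList v))

cycleStrategy-successProb : ∀ q n → 4 + q ≤ n → SuccessProbAtLeast n (rounds 2 n) q (cycleStrategy n)
cycleStrategy-successProb q (suc m) (s≤s 3+q≤m)
  with L , L! , L-covers , L-large
         ← covering-vectors _ q (q*[n*m^T]≤n^T m q (≤-trans (m≤n+m q 4) (s≤s 3+q≤m)))
  = L , L! , All.map (cycleStrategy-succeeds (≤-trans (m≤m+n 3 q) 3+q≤m) _) L-covers , L-large

lemma7p1 : ∃ λ (C : ℕ) → Σ ((n : ℕ) → Strategy n) λ strat →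
    ∀ (q : ℕ) → 1 ≤ q → ∃ λ (N : ℕ) → ∀ (n : ℕ) → N ≤ n →
    SuccessProbAtLeast n (rounds C n) q (strat n)
lemma7p1 = 2 , cycleStrategy , λ q _ → 4 + q , cycleStrategy-successProb q
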